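{- Let $G=(V,E)$ be a simple connected graph with $n=|V|$, and let $\{V_1,V_2,V_3,V_4\}$ be a feasible tetrapartition of $V$ with $|V_1|\le|V_2|\le|V_3|\le|V_4|$ and $|V_4|>\frac25 n$, to which no Merge and no Pull operation is applicable, and such that $|V_2|+|V_3|\ge|V_4|$, $|V_4|<\frac12 n$, $|V_1|\le|V_2|<\frac16|V_4|<\frac1{12}n$, and $|V_3|>\frac13 n$. Suppose we are in Case 3: for some $i\in\{1,2\}$ and $j=3-i$, $V_i$ is adjacent to $V_3$ at the vertex $v\in V_3$ (every edge between $V_i$ and $V_3$ is incident to $v$) and $V_j$ is adjacent to $V_4$ at the vertex $u\in V_4$ (every edge between $V_j$ and $V_4$ is incident to $u$). Then: (a) letting $V'_3$ be the union of the vertex sets of all connected components of $G[(V_3\cup V_i)\setminus\{v\}]$ that are adjacent to $V_4$, if $|V'_3|\le|V_i|+\frac7{24}|V_4|$ then $|V_4|\le\frac{24}{13}\,\mathrm{OPT}$; (b) letting $V'_4$ be the union of the vertex sets of all connected components of $G[(V_4\cup V_j)\setminus\{u\}]$ that are adjacent to $V_3$, if $|V'_4|\le|V_j|+\frac{11}{24}|V_4|$ then $|V_4|\le\frac{24}{13}\,\mathrm{OPT}$.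
   Context: A feasible tetrapartition of $V$ is a partition into four non-empty parts each inducing a connected subgraph of $G$; $\mathrm{OPT}$ is the minimum, over all feasible tetrapartitions, of the largest part size. Two disjoint vertex sets are adjacent if some edge joins them. For a sorted feasible tetrapartition with $|V_4|>\frac25 n$: a Merge operation is applicable if there are distinct $i,j\in\{1,2,3\}$ with $V_i,V_j$ adjacent and $|V_i|+|V_j|<|V_4|$; a Pull operation is applicable if no Merge is applicable and there exist $(i,j)\in\{(1,3),(1,4),(2,3),(2,4),(3,4)\}$ and a non-empty proper subset $U\subset V_j$ with $G[U]$ and $G[V_j\setminus U]$ connected, $U$ adjacent to $V_i$, and $|V_i|+|U|<|V_j|$. -}

module Defs where

open import Level using (0ℓ)
open import Data.Nat using (ℕ; _+_; _*_; _≤_; _<_; _⊔_)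
open import Data.Fin using (Fin; #_)
open import Data.Fin.Subset using (Subset; _∈_; _∉_; _∪_; _∩_; ∁; ⁅_⁆; ∣_∣; _⊆_; Nonempty)
open import Data.Product using (Σ; ∃; _×_; _,_)
open import Data.Sum using (_⊎_)
open import Data.Empty using (⊥)
open import Relation.Nullary using (¬_)
open import Relation.Binary.PropositionalEquality using (_≡_; _≢_)

record Graph (n : ℕ) : Set₁ where
  field
    E      : Fin n → Fin n → Set
    E-sym  : ∀ {x y} → E x y → E y x
    E-irr  : ∀ {x} → ¬ E x x
open Graph public

module _ {n : ℕ} (G : Graph n) where

  data WalkIn (S : Subset n) : Fin n → Fin n → Set where
    here : ∀ {x} → x ∈ S → WalkIn S x x
    step : ∀ {x y z} → x ∈ S → E G x y → WalkIn S y z → WalkIn S x z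

  -- G[S] is connected (vacuous for empty S)
  Connected : Subset n → Set
  Connected S = ∀ x y → x ∈ S → y ∈ S → WalkIn S x y

  Adjacent : Subset n → Subset n → Set
  Adjacent A B = Σ (Fin n) λ x → Σ (Fin n) λ y → x ∈ A × y ∈ B × E G x y

  -- feasible tetrapartition; part k (0-based) is V_{k+1} of the paper
  record FeasibleTetra (P : Fin 4 → Subset n) : Set where
    field
      disjoint  : ∀ k l → k ≢ l → ∀ x → x ∈ P k → x ∈ P l → ⊥
      cover     : ∀ x → Σ (Fin 4) λ k → x ∈ P k
      nonempty  : ∀ k → Nonempty (P k)
      connected : ∀ k → Connected (P k)

  maxPart : (Fin 4 → Subset n) → ℕ
  maxPart P = ∣ P (# 0) ∣ ⊔ ∣ P (# 1) ∣ ⊔ ∣ P (# 2) ∣ ⊔ ∣ P (# 3) ∣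

  IsOPT : ℕ → Set
  IsOPT k = (Σ (Fin 4 → Subset n) λ Q → FeasibleTetra Q × maxPart Q ≡ k)
          × (∀ Q → FeasibleTetra Q → k ≤ maxPart Q)

  Sorted : (Fin 4 → Subset n) → Set
  Sorted P = ∣ P (# 0) ∣ ≤ ∣ P (# 1) ∣ × ∣ P (# 1) ∣ ≤ ∣ P (# 2) ∣ × ∣ P (# 2) ∣ ≤ ∣ P (# 3) ∣

  data Small : Fin 4 → Set where
    s0 : Small (# 0)
    s1 : Small (# 1)
    s2 : Small (# 2)

  MergeApplicable : (Fin 4 → Subset n) → Set
  MergeApplicable P = Σ (Fin 4) λ i → Σ (Fin 4) λ j →
    Small i × Small j × i ≢ j × Adjacent (P i) (P j) × ∣ P i ∣ + ∣ P j ∣ < ∣ P (# 3) ∣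

  data PullPair : Fin 4 → Fin 4 → Set where
    p13 : PullPair (# 0) (# 2)
    p14 : PullPair (# 0) (# 3)
    p23 : PullPair (# 1) (# 2)
    p24 : PullPair (# 1) (# 3)
    p34 : PullPair (# 2) (# 3)

  PullApplicable : (Fin 4 → Subset n) → Set
  PullApplicable P = ¬ MergeApplicable P ×
    (Σ (Fin 4) λ i → Σ (Fin 4) λ j → Σ (Subset n) λ U →
       PullPair i j × Nonempty U × U ⊆ P j × (Σ (Fin n) λ x → x ∈ P j × x ∉ U) ×
       Connected U × Connected (P j ∩ ∁ U) × Adjacent U (P i) ×
       ∣ P i ∣ + ∣ U ∣ < ∣ P j ∣)

  EdgesAt : Subset n → Subset n → Fin n → Set
  EdgesAt A B w = ∀ x y → x ∈ A → y ∈ B → E G x y → x ≡ w ⊎ y ≡ w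

  AdjacentAt : Subset n → Subset n → Fin n → Set
  AdjacentAt A B w = w ∈ B × Adjacent A B × EdgesAt A B w

  ComponentsAdjacentTo : Subset n → Subset n → Subset n → Set
  ComponentsAdjacentTo S T W = ∀ x →
    (x ∈ W → x ∈ S × (Σ (Fin n) λ y → WalkIn S x y × Adjacent ⁅ y ⁆ T))
    × (x ∈ S × (Σ (Fin n) λ y → WalkIn S x y × Adjacent ⁅ y ⁆ T) → x ∈ W)

module Submission where

open import Defs
open import Data.Nat using (ℕ; _+_; _*_; _≤_; _<_; _≥_; _>_)
open import Data.Fin using (Fin; #_)
open import Data.Fin.Subset using (Subset; ⊤; _∪_; _∩_; ∁; ⁅_⁆; ∣_∣)
open import Data.Product using (_×_)
open import Data.Sum using (_⊎_)
open import Relation.Nullary using (¬_)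
open import Relation.Binary.PropositionalEquality using (_≡_)

-- Let A be the big part holding the hub h (V₃ and v in (a),
-- V₄ and u in (b)), B the small part attached to A at h, B' the other
-- small part, T the other big part, and W the union of the components of
-- G[(A ∪ B) ∖ {h}] adjacent to T.  As no Pull applies, every component C
-- of G[A ∖ {h}] has |C| ≤ |B| and is not adjacent to B'; hence a connected
-- set avoiding h that meets (A ∪ B) ∖ (W ∪ {h}) is trapped in B or in such
-- a C and has at most |B| vertices.  So an optimal tetrapartition either
-- has a part of size ≤ |B| ≤ |V₂|, or its part containing h contains
-- (A ∪ B) ∖ W, giving |A| + |B| ≤ OPT + |W|; linear arithmetic closes both
-- cases.  Reachability is not decidable constructively, so this argument
-- runs in the double-negation monad, under which the final inequality of
-- naturals is stable.

open import Data.Nat using (zero; suc; z≤n; s≤s; _≤?_; _⊔_)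
open import Data.Nat.Properties hiding (_≟_)
open import Data.Nat.Tactic.RingSolver using (solve-∀)
open import Data.Bool using (true)
open import Data.Fin using (zero; suc; _≟_)
open import Data.Fin.Subset using (_∈_; _∉_; _⊆_; Nonempty; outside; inside)
open import Data.Fin.Subset.Properties
open import Data.Vec using ([]; _∷_; here; there; tabulate)
open import Data.Vec.Properties using (lookup⇒[]=; []=⇒lookup; lookup∘tabulate)
open import Data.Product using (Σ; _,_; proj₁; proj₂; uncurry)
open import Data.Sum using (inj₁; inj₂; [_,_])
open import Data.Empty using (⊥; ⊥-elim)
open import Relation.Nullary using (Dec; yes; no; does)
open import Relation.Nullary.Decidable using (dec-true; decidable-stable; ¬¬-excluded-middle)
open import Relation.Nullary.Negation using (DoubleNegation; ¬¬-map)
open import Relation.Binary.PropositionalEquality using (_≢_; refl; sym; trans; subst)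
open import Function using (_∘_)

-- A combination of hypotheses whose left side provably exceeds its right
-- side is absurd; each estimate below refutes its negation this way.
overshoot : ∀ {lhs rhs} k → lhs ≡ rhs + suc k → lhs ≤ rhs → ⊥
overshoot {rhs = rhs} k eq le = m+1+n≰m rhs (subst (_≤ rhs) eq le)

double<d : ∀ b d → 6 * b < d → b + b < d
double<d b d 6b<d = ≤-<-trans (subst (b + b ≤_) (six b) (m≤m+n (b + b) (4 * b))) 6b<d
  where
  six : ∀ b → b + b + 4 * b ≡ 6 * b
  six = solve-∀

double<c : ∀ b c d → d ≤ b + c → 6 * b < d → b + b < c
double<c b c d d≤b+c 6b<d = ≰⇒> λ c≤2b → overshoot (3 * b) (rearrange b c d)
  (+-mono-≤ (+-mono-≤ d≤b+c 6b<d) c≤2b)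
  where
  rearrange : ∀ b c d → d + suc (6 * b) + c ≡ (b + c) + d + (b + b) + suc (3 * b)
  rearrange = solve-∀

smallPart-bound : ∀ n d b s opt → 2 * d < n → 6 * b < d → s ≤ b → n ≤ s + 3 * opt →
  13 * d ≤ 24 * opt
smallPart-bound n d b s opt 2d<n 6b<d s≤b n≤s+3opt = ≮⇒≥ λ 24opt<13d → overshoot (5 * d + 30)
  (rearrange n d b opt)
  (+-mono-≤ (+-mono-≤ (+-mono-≤ (*-monoʳ-≤ 24 2d<n) (*-monoʳ-≤ 24 n≤b+3opt))
    (*-monoʳ-≤ 3 24opt<13d)) (*-monoʳ-≤ 4 6b<d))
  where
  n≤b+3opt : n ≤ b + 3 * opt
  n≤b+3opt = ≤-trans n≤s+3opt (+-monoˡ-≤ (3 * opt) s≤b)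
  rearrange : ∀ n d b opt → 24 * suc (2 * d) + 24 * n + 3 * suc (24 * opt) + 4 * suc (6 * b)
            ≡ 24 * n + 24 * (b + 3 * opt) + 3 * (13 * d) + 4 * d + suc (5 * d + 30)
  rearrange = solve-∀

hubInV₃-bound : ∀ b c d opt s w → d ≤ b + c → 6 * b < d → 24 * w ≤ 24 * s + 7 * d →
  c + s ≤ opt + w → 13 * d ≤ 24 * opt
hubInV₃-bound b c d opt s w d≤b+c 6b<d w≤ c+s≤ = ≮⇒≥ λ 24opt<13d → overshoot 4
  (rearrange b c d opt s w)
  (+-mono-≤ (+-mono-≤ (+-mono-≤ (+-mono-≤ (*-monoʳ-≤ 24 d≤b+c) (*-monoʳ-≤ 4 6b<d))
    (*-monoʳ-≤ 24 c+s≤)) w≤) 24opt<13d)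
  where
  rearrange : ∀ b c d opt s w → 24 * d + 4 * suc (6 * b) + 24 * (c + s) + 24 * w + suc (24 * opt)
            ≡ 24 * (b + c) + 4 * d + 24 * (opt + w) + (24 * s + 7 * d) + 13 * d + suc 4
  rearrange = solve-∀

hubInV₄-bound : ∀ d opt s w → 24 * w ≤ 24 * s + 11 * d → d + s ≤ opt + w → 13 * d ≤ 24 * opt
hubInV₄-bound d opt s w w≤ d+s≤ = ≮⇒≥ λ 24opt<13d → overshoot 0
  (rearrange d opt s w)
  (+-mono-≤ (+-mono-≤ (*-monoʳ-≤ 24 d+s≤) w≤) 24opt<13d)
  where
  rearrange : ∀ d opt s w → 24 * (d + s) + 24 * w + suc (24 * opt)
            ≡ 24 * (opt + w) + (24 * s + 11 * d) + 13 * d + suc 0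
  rearrange = solve-∀

∣p∪q∣≤∣p∣+∣q∣ : ∀ {m} (p q : Subset m) → ∣ p ∪ q ∣ ≤ ∣ p ∣ + ∣ q ∣
∣p∪q∣≤∣p∣+∣q∣ []            []            = z≤n
∣p∪q∣≤∣p∣+∣q∣ (outside ∷ p) (outside ∷ q) = ∣p∪q∣≤∣p∣+∣q∣ p q
∣p∪q∣≤∣p∣+∣q∣ (outside ∷ p) (inside ∷ q)  =
  ≤-trans (s≤s (∣p∪q∣≤∣p∣+∣q∣ p q)) (≤-reflexive (sym (+-suc ∣ p ∣ ∣ q ∣)))
∣p∪q∣≤∣p∣+∣q∣ (inside ∷ p)  (s ∷ q)       =
  s≤s (≤-trans (∣p∪q∣≤∣p∣+∣q∣ p q) (+-monoʳ-≤ ∣ p ∣ (∣p∣≤∣x∷p∣ s q)))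

disjoint⇒∣p∣+∣q∣≤∣p∪q∣ : ∀ {m} (p q : Subset m) → (∀ {x} → x ∈ p → x ∈ q → ⊥) →
  ∣ p ∣ + ∣ q ∣ ≤ ∣ p ∪ q ∣
disjoint⇒∣p∣+∣q∣≤∣p∪q∣ []            []            _     = z≤n
disjoint⇒∣p∣+∣q∣≤∣p∪q∣ (outside ∷ p) (outside ∷ q) p∩q=∅ =
  disjoint⇒∣p∣+∣q∣≤∣p∪q∣ p q λ x∈p x∈q → p∩q=∅ (there x∈p) (there x∈q)
disjoint⇒∣p∣+∣q∣≤∣p∪q∣ (outside ∷ p) (inside ∷ q)  p∩q=∅ =
  ≤-trans (≤-reflexive (+-suc ∣ p ∣ ∣ q ∣))
    (s≤s (disjoint⇒∣p∣+∣q∣≤∣p∪q∣ p q λ x∈p x∈q → p∩q=∅ (there x∈p) (there x∈q)))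
disjoint⇒∣p∣+∣q∣≤∣p∪q∣ (inside ∷ p)  (outside ∷ q) p∩q=∅ =
  s≤s (disjoint⇒∣p∣+∣q∣≤∣p∪q∣ p q λ x∈p x∈q → p∩q=∅ (there x∈p) (there x∈q))
disjoint⇒∣p∣+∣q∣≤∣p∪q∣ (inside ∷ p)  (inside ∷ q)  p∩q=∅ = ⊥-elim (p∩q=∅ here here)

∈-diff⁺ : ∀ {m} {X Y : Subset m} {z} → z ∈ X → z ∉ Y → z ∈ X ∩ ∁ Y
∈-diff⁺ z∈X z∉Y = x∈p∩q⁺ (z∈X , x∉p⇒x∈∁p z∉Y)

∈-diff⁻ : ∀ {m} {X Y : Subset m} {z} → z ∈ X ∩ ∁ Y → z ∈ X × z ∉ Y
∈-diff⁻ {X = X} {Y} z∈X∖Y with x∈p∩q⁻ X (∁ Y) z∈X∖Y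
... | z∈X , z∈∁Y = z∈X , x∈∁p⇒x∉p z∈∁Y

∈-punct⁺ : ∀ {m} {X : Subset m} {h z} → z ∈ X → z ≢ h → z ∈ X ∩ ∁ ⁅ h ⁆
∈-punct⁺ z∈X z≢h = ∈-diff⁺ z∈X (x≢y⇒x∉⁅y⁆ z≢h)

∈-punct⁻ : ∀ {m} {X : Subset m} {h z} → z ∈ X ∩ ∁ ⁅ h ⁆ → z ∈ X × z ≢ h
∈-punct⁻ {h = h} z∈X∖h with ∈-diff⁻ z∈X∖h
... | z∈X , z∉h = z∈X , λ z≡h → z∉h (subst (_∈ ⁅ h ⁆) (sym z≡h) (x∈⁅x⁆ h))

subsetOf : ∀ {m} {P : Fin m → Set} → (∀ y → Dec (P y)) → Subset m
subsetOf P? = tabulate λ y → does (P? y)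

∈-subsetOf⁺ : ∀ {m} {P : Fin m → Set} (P? : ∀ y → Dec (P y)) {y} → P y → y ∈ subsetOf P?
∈-subsetOf⁺ P? {y} Py =
  lookup⇒[]= y (subsetOf P?) (trans (lookup∘tabulate _ y) (dec-true (P? y) Py))

∈-subsetOf⁻ : ∀ {m} {P : Fin m → Set} (P? : ∀ y → Dec (P y)) {y} → y ∈ subsetOf P? → P y
∈-subsetOf⁻ P? {y} y∈ = accepted (P? y) (trans (sym (lookup∘tabulate _ y)) ([]=⇒lookup y∈))
  where
  accepted : ∀ {A : Set} (A? : Dec A) → does A? ≡ true → A
  accepted (yes a) _ = a
  accepted (no _)  ()

¬¬-decideAll : ∀ {m} (P : Fin m → Set) → DoubleNegation (∀ y → Dec (P y))
¬¬-decideAll {zero}  P k = k λ ()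
¬¬-decideAll {suc m} P k = ¬¬-excluded-middle λ P0? → ¬¬-decideAll (λ y → P (suc y)) λ Ps? →
  k λ { zero → P0? ; (suc y) → Ps? y }

module Walks {n : ℕ} (G : Graph n) where

  walk-start : ∀ {S x y} → WalkIn G S x y → x ∈ S
  walk-start (here x∈S)     = x∈S
  walk-start (step x∈S _ _) = x∈S

  walk-end : ∀ {S x y} → WalkIn G S x y → y ∈ S
  walk-end (here y∈S)   = y∈S
  walk-end (step _ _ w) = walk-end w

  walk-snoc : ∀ {S x y z} → WalkIn G S x y → z ∈ S → E G y z → WalkIn G S x z
  walk-snoc (here y∈S)      z∈S e = step y∈S e (here z∈S)
  walk-snoc (step x∈S e' w) z∈S e = step x∈S e' (walk-snoc w z∈S e)

  walk-++ : ∀ {S x y z} → WalkIn G S x y → WalkIn G S y z → WalkIn G S x z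
  walk-++ (here _)       w' = w'
  walk-++ (step x∈S e w) w' = step x∈S e (walk-++ w w')

  walk-reverse : ∀ {S x y} → WalkIn G S x y → WalkIn G S y x
  walk-reverse (here x∈S)     = here x∈S
  walk-reverse (step x∈S e w) = walk-snoc (walk-reverse w) x∈S (E-sym G e)

  walk-mono : ∀ {S S' x y} → S ⊆ S' → WalkIn G S x y → WalkIn G S' x y
  walk-mono S⊆S' (here x∈S)     = here (S⊆S' x∈S)
  walk-mono S⊆S' (step x∈S e w) = step (S⊆S' x∈S) e (walk-mono S⊆S' w)

  walk-restrict : ∀ {S S' a x y} → (∀ {z} → WalkIn G S a z → z ∈ S') →
    WalkIn G S a x → WalkIn G S x y → WalkIn G S' x y
  walk-restrict reach⊆ a→x (here _)       = here (reach⊆ a→x)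
  walk-restrict reach⊆ a→x (step _ e w) =
    step (reach⊆ a→x) e (walk-restrict reach⊆ (walk-snoc a→x (walk-start w) e) w)

  confined : ∀ {Y} (X : Fin n → Set) → Connected G Y →
    (∀ {z w} → X z → w ∈ Y → E G z w → X w) →
    ∀ {x} → x ∈ Y → X x → ∀ {y} → y ∈ Y → X y
  confined {Y} X connY closed {x} x∈Y Xx {y} y∈Y = along (connY x y x∈Y y∈Y) Xx
    where
    along : ∀ {z y} → WalkIn G Y z y → X z → X y
    along (here _)     Xz = Xz
    along (step _ e w) Xz = along w (closed Xz (walk-start w) e)

NoPull : ∀ {n} (G : Graph n) → Subset n → Subset n → Set
NoPull {n} G A B = ∀ U → Nonempty U → U ⊆ A → (Σ (Fin n) λ x → x ∈ A × x ∉ U) →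
  Connected G U → Connected G (A ∩ ∁ U) → Adjacent G U B → ¬ (∣ B ∣ + ∣ U ∣ < ∣ A ∣)

noPull-along : ∀ {n} (G : Graph n) (P : Fin 4 → Subset n) →
  ¬ MergeApplicable G P → ¬ PullApplicable G P →
  ∀ {i k} → PullPair G i k → NoPull G (P k) (P i)
noPull-along G P no-merge no-pull {i} {k} pair U U≢∅ U⊆ U≢Pk conn-U conn-rest adj lt =
  no-pull (no-merge , i , k , U , pair , U≢∅ , U⊆ , U≢Pk , conn-U , conn-rest , adj , lt)

module Attachment {n : ℕ} (G : Graph n) (A B B' : Subset n) (h : Fin n)
  (A∩B=∅ : ∀ {x} → x ∈ A → x ∈ B → ⊥)
  (connected-A : Connected G A)
  (attached : AdjacentAt G B A h)
  (B≁B' : ¬ Adjacent G B B')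
  (∣B∣+∣B'∣<∣A∣ : ∣ B ∣ + ∣ B' ∣ < ∣ A ∣)
  (no-pull-B : NoPull G A B) (no-pull-B' : NoPull G A B') where

  open Walks G

  h∈A : h ∈ A
  h∈A = proj₁ attached

  edges-at-h : EdgesAt G B A h
  edges-at-h = proj₂ (proj₂ attached)

  A⁻ : Subset n
  A⁻ = A ∩ ∁ ⁅ h ⁆

  module Component {x : Fin n} (x∈A⁻ : x ∈ A⁻) (reach? : ∀ y → Dec (WalkIn G A⁻ x y)) where

    C : Subset n
    C = subsetOf reach?

    C⊆A⁻ : C ⊆ A⁻
    C⊆A⁻ y∈C = walk-end (∈-subsetOf⁻ reach? y∈C)

    C⊆A : C ⊆ A
    C⊆A y∈C = proj₁ (∈-punct⁻ (C⊆A⁻ y∈C))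

    x∈C : x ∈ C
    x∈C = ∈-subsetOf⁺ reach? (here x∈A⁻)

    h∉C : h ∉ C
    h∉C h∈C = proj₂ (∈-punct⁻ (C⊆A⁻ h∈C)) refl

    C-closed : ∀ {z w} → z ∈ C → w ∈ A⁻ → E G z w → w ∈ C
    C-closed z∈C w∈A⁻ e = ∈-subsetOf⁺ reach? (walk-snoc (∈-subsetOf⁻ reach? z∈C) w∈A⁻ e)

    connected-C : Connected G C
    connected-C y y' y∈C y'∈C = walk-++ (walk-reverse (from-x y∈C)) (from-x y'∈C)
      where
      from-x : ∀ {y} → y ∈ C → WalkIn G C x y
      from-x y∈C = walk-restrict (∈-subsetOf⁺ reach?) (here x∈A⁻) (∈-subsetOf⁻ reach? y∈C)

    U : Subset n
    U = A ∩ ∁ C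

    h∈U : h ∈ U
    h∈U = ∈-diff⁺ h∈A h∉C

    -- A walk in A from a vertex of U to the hub can be cut to one inside U:
    -- before reaching h it never enters C, as C is closed in A ∖ {h}.
    to-hub : ∀ {z} → z ∈ U → WalkIn G A z h → WalkIn G U z h
    to-hub {z} z∈U walk with z ≟ h
    ... | yes refl = here h∈U
    to-hub z∈U (here _) | no z≢h = ⊥-elim (z≢h refl)
    to-hub z∈U (step {y = w} z∈A e rest) | no z≢h = step z∈U e (to-hub w∈U rest)
      where
      w∈U : w ∈ U
      w∈U = ∈-diff⁺ (walk-start rest) λ w∈C →
        proj₂ (∈-diff⁻ z∈U) (C-closed w∈C (∈-punct⁺ z∈A z≢h) (E-sym G e))

    connected-U : Connected G U
    connected-U y y' y∈U y'∈U = walk-++ (to-h y∈U) (walk-reverse (to-h y'∈U))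
      where
      to-h : ∀ {y} → y ∈ U → WalkIn G U y h
      to-h {y} y∈U = to-hub y∈U (connected-A y h (proj₁ (∈-diff⁻ y∈U)) h∈A)

    -- A ∖ U is C again, hence connected.
    connected-A∖U : Connected G (A ∩ ∁ U)
    connected-A∖U y y' y∈ y'∈ = walk-mono C⊆A∖U (connected-C y y' (A∖U⊆C y∈) (A∖U⊆C y'∈))
      where
      C⊆A∖U : C ⊆ A ∩ ∁ U
      C⊆A∖U z∈C = ∈-diff⁺ (C⊆A z∈C) λ z∈U → proj₂ (∈-diff⁻ z∈U) z∈C
      A∖U⊆C : A ∩ ∁ U ⊆ C
      A∖U⊆C {z} z∈A∖U with z ∈? C | ∈-diff⁻ z∈A∖U
      ... | yes z∈C | _           = z∈C
      ... | no z∉C  | z∈A , z∉U = ⊥-elim (z∉U (∈-diff⁺ z∈A z∉C))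

    -- U meets B through the hub, since every edge between A and B uses h.
    U-adj-B : Adjacent G U B
    U-adj-B with proj₁ (proj₂ attached)
    ... | b , a , b∈B , a∈A , e with edges-at-h b a b∈B a∈A e
    ...   | inj₁ b≡h = ⊥-elim (A∩B=∅ (subst (_∈ A) (sym b≡h) h∈A) b∈B)
    ...   | inj₂ a≡h = h , b , h∈U , b∈B , E-sym G (subst (E G b) a≡h e)

    ∣U∣+∣C∣≤∣A∣ : ∣ U ∣ + ∣ C ∣ ≤ ∣ A ∣
    ∣U∣+∣C∣≤∣A∣ = ≤-trans (disjoint⇒∣p∣+∣q∣≤∣p∪q∣ U C λ z∈U z∈C → proj₂ (∈-diff⁻ z∈U) z∈C)
      (p⊆q⇒∣p∣≤∣q∣ λ z∈U∪C → [ (λ z∈U → proj₁ (∈-diff⁻ z∈U)) , C⊆A ] (x∈p∪q⁻ U C z∈U∪C))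

    -- U cannot be pulled onto B, so C is no larger than B.
    ∣C∣≤∣B∣ : ∣ C ∣ ≤ ∣ B ∣
    ∣C∣≤∣B∣ = ≮⇒≥ λ ∣B∣<∣C∣ → no-pull-B U (h , h∈U) (λ z∈U → proj₁ (∈-diff⁻ z∈U))
      (x , C⊆A x∈C , λ x∈U → proj₂ (∈-diff⁻ x∈U) x∈C) connected-U connected-A∖U U-adj-B
      (begin-strict
        ∣ B ∣ + ∣ U ∣ <⟨ +-monoˡ-< ∣ U ∣ ∣B∣<∣C∣ ⟩
        ∣ C ∣ + ∣ U ∣ ≡⟨ +-comm ∣ C ∣ ∣ U ∣ ⟩
        ∣ U ∣ + ∣ C ∣ ≤⟨ ∣U∣+∣C∣≤∣A∣ ⟩
        ∣ A ∣         ∎)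
      where open ≤-Reasoning

    -- C cannot be pulled onto B', so C is not adjacent to B'.
    C≁B' : ¬ Adjacent G C B'
    C≁B' C-adj-B' = no-pull-B' C (x , x∈C) C⊆A (h , h∈A , h∉C) connected-C connected-U C-adj-B'
      (begin-strict
        ∣ B' ∣ + ∣ C ∣ ≤⟨ +-monoʳ-≤ ∣ B' ∣ ∣C∣≤∣B∣ ⟩
        ∣ B' ∣ + ∣ B ∣ ≡⟨ +-comm ∣ B' ∣ ∣ B ∣ ⟩
        ∣ B ∣ + ∣ B' ∣ <⟨ ∣B∣+∣B'∣<∣A∣ ⟩
        ∣ A ∣          ∎)
      where open ≤-Reasoning

  module Trapping (T W : Subset n)
    (four-parts : ∀ w → w ∈ A ⊎ w ∈ B ⊎ w ∈ B' ⊎ w ∈ T)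
    (W-components : ComponentsAdjacentTo G ((A ∪ B) ∩ ∁ ⁅ h ⁆) T W) where

    S : Subset n
    S = (A ∪ B) ∩ ∁ ⁅ h ⁆

    Stranded : Fin n → Set
    Stranded z = z ∈ S × z ∉ W

    -- W is a union of components, so its complement in S is closed under edges of S ...
    stranded-step : ∀ {z w} → Stranded z → E G z w → w ∈ A ∪ B → w ≢ h → Stranded w
    stranded-step {z} {w} (z∈S , z∉W) e w∈A∪B w≢h = ∈-punct⁺ w∈A∪B w≢h , λ w∈W → z∉W (pull-back w∈W)
      where
      pull-back : w ∈ W → z ∈ W
      pull-back w∈W with proj₁ (W-components w) w∈W
      ... | _ , y , w→y , y-adj-T = proj₂ (W-components z) (z∈S , y , step z∈S e w→y , y-adj-T)

    stranded-¬T : ∀ {z w} → Stranded z → E G z w → w ∉ T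
    stranded-¬T {z} {w} (z∈S , z∉W) e w∈T =
      z∉W (proj₂ (W-components z) (z∈S , z , here z∈S , z , w , x∈⁅x⁆ z , w∈T , e))

    -- Avoiding h, one cannot leave the stranded part of B: edges to A use
    -- the hub, and B is not adjacent to B'.
    B-trap : ∀ {z w} → Stranded z × z ∈ B → E G z w → w ≢ h → Stranded w × w ∈ B
    B-trap {z} {w} (str , z∈B) e w≢h with four-parts w
    ... | inj₁ w∈A with edges-at-h z w z∈B w∈A e
    ...   | inj₁ z≡h = ⊥-elim (proj₂ (∈-punct⁻ (proj₁ str)) z≡h)
    ...   | inj₂ w≡h = ⊥-elim (w≢h w≡h)
    B-trap (str , z∈B) e w≢h | inj₂ (inj₁ w∈B) = stranded-step str e (x∈p∪q⁺ (inj₂ w∈B)) w≢h , w∈B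
    B-trap (str , z∈B) e w≢h | inj₂ (inj₂ (inj₁ w∈B')) = ⊥-elim (B≁B' (_ , _ , z∈B , w∈B' , e))
    B-trap (str , z∈B) e w≢h | inj₂ (inj₂ (inj₂ w∈T)) = ⊥-elim (stranded-¬T str e w∈T)

    -- A connected set avoiding h that contains a stranded vertex has at most
    -- |B| vertices: it is trapped in B, or in a component C of G[A ∖ {h}].
    trapped : ∀ {Y} → Connected G Y → h ∉ Y → ∀ {x} → x ∈ Y → Stranded x →
      DoubleNegation (∣ Y ∣ ≤ ∣ B ∣)
    trapped {Y} connected-Y h∉Y {x} x∈Y str-x =
      by-side (x∈p∪q⁻ A B (proj₁ (∈-punct⁻ (proj₁ str-x))))
      where
      ≢h : ∀ {w} → w ∈ Y → w ≢ h
      ≢h w∈Y w≡h = h∉Y (subst (_∈ Y) w≡h w∈Y)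

      within-B : x ∈ B → Y ⊆ B
      within-B x∈B y∈Y =
        proj₂ (confined _ connected-Y (λ inv w∈Y e → B-trap inv e (≢h w∈Y)) x∈Y (str-x , x∈B) y∈Y)

      within-component : x ∈ A → (∀ y → Dec (WalkIn G A⁻ x y)) → ∣ Y ∣ ≤ ∣ B ∣
      within-component x∈A reach? = ≤-trans (p⊆q⇒∣p∣≤∣q∣ Y⊆C) ∣C∣≤∣B∣
        where
        open Component (∈-punct⁺ x∈A (proj₂ (∈-punct⁻ (proj₁ str-x)))) reach?

        -- Avoiding h, one cannot leave the stranded part of C: edges to B
        -- use the hub, and C is not adjacent to B'.
        C-trap : ∀ {z w} → Stranded z × z ∈ C → E G z w → w ≢ h → Stranded w × w ∈ C
        C-trap {z} {w} (str , z∈C) e w≢h with four-parts w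
        ... | inj₁ w∈A =
          stranded-step str e (x∈p∪q⁺ (inj₁ w∈A)) w≢h , C-closed z∈C (∈-punct⁺ w∈A w≢h) e
        ... | inj₂ (inj₁ w∈B) with edges-at-h w z w∈B (C⊆A z∈C) (E-sym G e)
        ...   | inj₁ w≡h = ⊥-elim (w≢h w≡h)
        ...   | inj₂ z≡h = ⊥-elim (h∉C (subst (_∈ C) z≡h z∈C))
        C-trap (str , z∈C) e w≢h | inj₂ (inj₂ (inj₁ w∈B')) = ⊥-elim (C≁B' (_ , _ , z∈C , w∈B' , e))
        C-trap (str , z∈C) e w≢h | inj₂ (inj₂ (inj₂ w∈T)) = ⊥-elim (stranded-¬T str e w∈T)

        Y⊆C : Y ⊆ C
        Y⊆C y∈Y = proj₂ (confined _ connected-Y (λ inv w∈Y e → C-trap inv e (≢h w∈Y))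
          x∈Y (str-x , x∈C) y∈Y)

      by-side : x ∈ A ⊎ x ∈ B → DoubleNegation (∣ Y ∣ ≤ ∣ B ∣)
      by-side (inj₂ x∈B) ∣Y∣≰∣B∣ = ∣Y∣≰∣B∣ (p⊆q⇒∣p∣≤∣q∣ (within-B x∈B))
      by-side (inj₁ x∈A) = ¬¬-map (within-component x∈A) (¬¬-decideAll (WalkIn G A⁻ x))

    dichotomy : (Q : Fin 4 → Subset n) → FeasibleTetra G Q →
      DoubleNegation ((Σ (Fin 4) λ k → ∣ Q k ∣ ≤ ∣ B ∣) ⊎
                      (Σ (Fin 4) λ k → ∣ A ∣ + ∣ B ∣ ≤ ∣ Q k ∣ + ∣ W ∣))
    dichotomy Q fQ conclusion-fails = escape? λ
      { (yes (x , l , str , x∈Ql , h∉Ql)) →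
          trapped (connected l) h∉Ql x∈Ql str λ small → conclusion-fails (inj₁ (l , small))
      ; (no no-escape) → conclusion-fails (inj₂ (hub-part no-escape)) }
      where
      open FeasibleTetra fQ

      Escape : Set
      Escape = Σ (Fin n) λ x → Σ (Fin 4) λ l → Stranded x × x ∈ Q l × h ∉ Q l

      escape? : DoubleNegation (Dec Escape)
      escape? = ¬¬-excluded-middle

      hub-part : ¬ Escape → Σ (Fin 4) λ k → ∣ A ∣ + ∣ B ∣ ≤ ∣ Q k ∣ + ∣ W ∣
      hub-part no-escape with cover h
      ... | k₀ , h∈Qk₀ = k₀ , (begin
            ∣ A ∣ + ∣ B ∣     ≤⟨ disjoint⇒∣p∣+∣q∣≤∣p∪q∣ A B A∩B=∅ ⟩
            ∣ A ∪ B ∣         ≤⟨ p⊆q⇒∣p∣≤∣q∣ A∪B⊆Qk₀∪W ⟩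
            ∣ Q k₀ ∪ W ∣      ≤⟨ ∣p∪q∣≤∣p∣+∣q∣ (Q k₀) W ⟩
            ∣ Q k₀ ∣ + ∣ W ∣  ∎)
        where
        open ≤-Reasoning
        -- a vertex of A ∪ B outside W ∪ {h} is stranded, so its part of Q
        -- contains h and is therefore Q k₀
        A∪B⊆Qk₀∪W : A ∪ B ⊆ Q k₀ ∪ W
        A∪B⊆Qk₀∪W {x} x∈A∪B with x ≟ h | x ∈? W
        ... | yes refl | _       = x∈p∪q⁺ (inj₁ h∈Qk₀)
        ... | no _     | yes x∈W = x∈p∪q⁺ (inj₂ x∈W)
        ... | no x≢h   | no x∉W with cover x
        ...   | l , x∈Ql with h ∈? Q l
        ...     | no h∉Ql = ⊥-elim (no-escape (x , l , (∈-punct⁺ x∈A∪B x≢h , x∉W) , x∈Ql , h∉Ql))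
        ...     | yes h∈Ql with l ≟ k₀
        ...       | yes refl = x∈p∪q⁺ (inj₁ x∈Ql)
        ...       | no l≢k₀  = ⊥-elim (disjoint l k₀ l≢k₀ h h∈Ql h∈Qk₀)

sum4≤ : ∀ (f : Fin 4 → ℕ) o → (∀ l → f l ≤ o) →
  ∀ k → (f (# 0) + f (# 1)) + (f (# 2) + f (# 3)) ≤ f k + 3 * o
sum4≤ f o f≤o zero = ≤-trans
  (+-mono-≤ (+-monoʳ-≤ (f (# 0)) (f≤o (# 1))) (+-mono-≤ (f≤o (# 2)) (f≤o (# 3))))
  (≤-reflexive (regroup (f (# 0)) o))
  where
  regroup : ∀ a o → (a + o) + (o + o) ≡ a + 3 * o
  regroup = solve-∀
sum4≤ f o f≤o (suc zero) = ≤-trans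
  (+-mono-≤ (+-monoˡ-≤ (f (# 1)) (f≤o (# 0))) (+-mono-≤ (f≤o (# 2)) (f≤o (# 3))))
  (≤-reflexive (regroup (f (# 1)) o))
  where
  regroup : ∀ a o → (o + a) + (o + o) ≡ a + 3 * o
  regroup = solve-∀
sum4≤ f o f≤o (suc (suc zero)) = ≤-trans
  (+-mono-≤ (+-mono-≤ (f≤o (# 0)) (f≤o (# 1))) (+-monoʳ-≤ (f (# 2)) (f≤o (# 3))))
  (≤-reflexive (regroup (f (# 2)) o))
  where
  regroup : ∀ a o → (o + o) + (a + o) ≡ a + 3 * o
  regroup = solve-∀
sum4≤ f o f≤o (suc (suc (suc zero))) = ≤-trans
  (+-mono-≤ (+-mono-≤ (f≤o (# 0)) (f≤o (# 1))) (+-monoˡ-≤ (f (# 3)) (f≤o (# 2))))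
  (≤-reflexive (regroup (f (# 3)) o))
  where
  regroup : ∀ a o → (o + o) + (o + a) ≡ a + 3 * o
  regroup = solve-∀

module PartSizes {n : ℕ} (G : Graph n) (Q : Fin 4 → Subset n) (fQ : FeasibleTetra G Q) where

  open FeasibleTetra fQ

  part≤max : ∀ k → ∣ Q k ∣ ≤ maxPart G Q
  part≤max = below-max
    where
    q₀ = ∣ Q (# 0) ∣
    q₁ = ∣ Q (# 1) ∣
    q₂ = ∣ Q (# 2) ∣
    q₃ = ∣ Q (# 3) ∣
    below-max : ∀ k → ∣ Q k ∣ ≤ q₀ ⊔ q₁ ⊔ q₂ ⊔ q₃
    below-max zero = ≤-trans (m≤m⊔n q₀ q₁) (≤-trans (m≤m⊔n (q₀ ⊔ q₁) q₂) (m≤m⊔n (q₀ ⊔ q₁ ⊔ q₂) q₃))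
    below-max (suc zero) = ≤-trans (m≤n⊔m q₀ q₁) (≤-trans (m≤m⊔n (q₀ ⊔ q₁) q₂) (m≤m⊔n (q₀ ⊔ q₁ ⊔ q₂) q₃))
    below-max (suc (suc zero)) = ≤-trans (m≤n⊔m (q₀ ⊔ q₁) q₂) (m≤m⊔n (q₀ ⊔ q₁ ⊔ q₂) q₃)
    below-max (suc (suc (suc zero))) = m≤n⊔m (q₀ ⊔ q₁ ⊔ q₂) q₃

  n≤sum : n ≤ (∣ Q (# 0) ∣ + ∣ Q (# 1) ∣) + (∣ Q (# 2) ∣ + ∣ Q (# 3) ∣)
  n≤sum = begin
    n                                                 ≡⟨ sym (∣⊤∣≡n n) ⟩
    ∣ ⊤ {n} ∣                                         ≤⟨ p⊆q⇒∣p∣≤∣q∣ {p = ⊤} (λ {x} _ → in-union x) ⟩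
    ∣ (Q (# 0) ∪ Q (# 1)) ∪ (Q (# 2) ∪ Q (# 3)) ∣     ≤⟨ ∣p∪q∣≤∣p∣+∣q∣ (Q (# 0) ∪ Q (# 1)) (Q (# 2) ∪ Q (# 3)) ⟩
    ∣ Q (# 0) ∪ Q (# 1) ∣ + ∣ Q (# 2) ∪ Q (# 3) ∣     ≤⟨ +-mono-≤ (∣p∪q∣≤∣p∣+∣q∣ (Q (# 0)) (Q (# 1))) (∣p∪q∣≤∣p∣+∣q∣ (Q (# 2)) (Q (# 3))) ⟩
    (∣ Q (# 0) ∣ + ∣ Q (# 1) ∣) + (∣ Q (# 2) ∣ + ∣ Q (# 3) ∣) ∎
    where
    open ≤-Reasoning
    in-union : ∀ x → x ∈ (Q (# 0) ∪ Q (# 1)) ∪ (Q (# 2) ∪ Q (# 3))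
    in-union x with cover x
    ... | zero , x∈Q                   = x∈p∪q⁺ (inj₁ (x∈p∪q⁺ (inj₁ x∈Q)))
    ... | suc zero , x∈Q               = x∈p∪q⁺ (inj₁ (x∈p∪q⁺ (inj₂ x∈Q)))
    ... | suc (suc zero) , x∈Q         = x∈p∪q⁺ (inj₂ (x∈p∪q⁺ (inj₁ x∈Q)))
    ... | suc (suc (suc zero)) , x∈Q   = x∈p∪q⁺ (inj₂ (x∈p∪q⁺ (inj₂ x∈Q)))

  n≤part+3max : ∀ k → n ≤ ∣ Q k ∣ + 3 * maxPart G Q
  n≤part+3max k = ≤-trans n≤sum (sum4≤ (λ l → ∣ Q l ∣) (maxPart G Q) part≤max k)

data Roles : Fin 4 → Fin 4 → Set where
  roles₀₁ : Roles (# 0) (# 1)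
  roles₁₀ : Roles (# 1) (# 0)

-- {a, t} = {3, 4} (0-based {2, 3}): a holds the hub, t is the other big part.
data BigRoles : Fin 4 → Fin 4 → Set where
  big₂₃ : BigRoles (# 2) (# 3)
  big₃₂ : BigRoles (# 3) (# 2)

toRoles : ∀ {i j : Fin 4} → (i ≡ # 0 × j ≡ # 1) ⊎ (i ≡ # 1 × j ≡ # 0) → Roles i j
toRoles (inj₁ (refl , refl)) = roles₀₁
toRoles (inj₂ (refl , refl)) = roles₁₀

-- The two small parts exchange their roles between (a) and (b).
roles-swap : ∀ {i j} → Roles i j → Roles j i
roles-swap roles₀₁ = roles₁₀
roles-swap roles₁₀ = roles₀₁

roles-≢ : ∀ {i j} → Roles i j → i ≢ j
roles-≢ roles₀₁ ()
roles-≢ roles₁₀ ()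

roles-small : ∀ {n} {G : Graph n} {i j} → Roles i j → Small G i
roles-small roles₀₁ = s0
roles-small roles₁₀ = s1

roles-pull : ∀ {n} {G : Graph n} {i j a t} → Roles i j → BigRoles a t → PullPair G i a
roles-pull roles₀₁ big₂₃ = p13
roles-pull roles₀₁ big₃₂ = p14
roles-pull roles₁₀ big₂₃ = p23
roles-pull roles₁₀ big₃₂ = p24

pull-≢ : ∀ {n} {G : Graph n} {i k} → PullPair G i k → i ≢ k
pull-≢ p13 ()
pull-≢ p14 ()
pull-≢ p23 ()
pull-≢ p24 ()
pull-≢ p34 ()

roles-bounded : ∀ {n} {G : Graph n} {P : Fin 4 → Subset n} → Sorted G P →
  ∀ {i j} → Roles i j → ∣ P i ∣ ≤ ∣ P (# 1) ∣
roles-bounded (∣V₁∣≤∣V₂∣ , _) roles₀₁ = ∣V₁∣≤∣V₂∣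
roles-bounded _               roles₁₀ = ≤-refl

fin4-cases : ∀ (F : Fin 4 → Set) k → F k → F (# 0) ⊎ F (# 1) ⊎ F (# 2) ⊎ F (# 3)
fin4-cases F zero                   x = inj₁ x
fin4-cases F (suc zero)             x = inj₂ (inj₁ x)
fin4-cases F (suc (suc zero))       x = inj₂ (inj₂ (inj₁ x))
fin4-cases F (suc (suc (suc zero))) x = inj₂ (inj₂ (inj₂ x))

role-cases : ∀ (F : Fin 4 → Set) {i j a t} → Roles i j → BigRoles a t →
  ∀ k → F k → F a ⊎ F i ⊎ F j ⊎ F t
role-cases F r b k x = arrange r b (fin4-cases F k x)
  where
  arrange : ∀ {i j a t} → Roles i j → BigRoles a t →
    F (# 0) ⊎ F (# 1) ⊎ F (# 2) ⊎ F (# 3) → F a ⊎ F i ⊎ F j ⊎ F t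
  arrange roles₀₁ big₂₃ = [ inj₂ ∘ inj₁ , [ inj₂ ∘ inj₂ ∘ inj₁ , [ inj₁ , inj₂ ∘ inj₂ ∘ inj₂ ] ] ]
  arrange roles₁₀ big₂₃ = [ inj₂ ∘ inj₂ ∘ inj₁ , [ inj₂ ∘ inj₁ , [ inj₁ , inj₂ ∘ inj₂ ∘ inj₂ ] ] ]
  arrange roles₀₁ big₃₂ = [ inj₂ ∘ inj₁ , [ inj₂ ∘ inj₂ ∘ inj₁ , [ inj₂ ∘ inj₂ ∘ inj₂ , inj₁ ] ] ]
  arrange roles₁₀ big₃₂ = [ inj₂ ∘ inj₂ ∘ inj₁ , [ inj₂ ∘ inj₁ , [ inj₂ ∘ inj₂ ∘ inj₂ , inj₁ ] ] ]

hub-dichotomy : ∀ {n} (G : Graph n) (P : Fin 4 → Subset n) → FeasibleTetra G P →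
  ¬ MergeApplicable G P → ¬ PullApplicable G P →
  ∀ {i j a t} → Roles i j → BigRoles a t →
  ∣ P i ∣ + ∣ P j ∣ < ∣ P (# 3) ∣ → ∣ P i ∣ + ∣ P j ∣ < ∣ P a ∣ →
  ∀ {h} → AdjacentAt G (P i) (P a) h →
  ∀ {W} → ComponentsAdjacentTo G ((P a ∪ P i) ∩ ∁ ⁅ h ⁆) (P t) W →
  ∀ {opt} → IsOPT G opt →
  DoubleNegation (n ≤ ∣ P i ∣ + 3 * opt ⊎ ∣ P a ∣ + ∣ P i ∣ ≤ opt + ∣ W ∣)
hub-dichotomy {n} G P fP no-merge no-pull {i} {j} {a} {t} r b ij<V₄ ij<Va {h} attached {W} W-comps
  ((Q , fQ , refl) , _) = ¬¬-map bound-opt (dichotomy Q fQ)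
  where
  open FeasibleTetra fP
  open PartSizes G Q fQ
  open Attachment G (P a) (P i) (P j) h
    (λ {x} x∈Pa x∈Pi → disjoint a i (pull-≢ (roles-pull {G = G} r b) ∘ sym) x x∈Pa x∈Pi)
    (connected a) attached
    (λ adj → no-merge (i , j , roles-small r , roles-small (roles-swap r) , roles-≢ r , adj , ij<V₄))
    ij<Va
    (noPull-along G P no-merge no-pull (roles-pull r b))
    (noPull-along G P no-merge no-pull (roles-pull (roles-swap r) b))
  open Trapping (P t) W (λ w → uncurry (role-cases (λ k → w ∈ P k) r b) (cover w)) W-comps

  bound-opt : (Σ (Fin 4) λ k → ∣ Q k ∣ ≤ ∣ P i ∣) ⊎ (Σ (Fin 4) λ k → ∣ P a ∣ + ∣ P i ∣ ≤ ∣ Q k ∣ + ∣ W ∣) →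
    n ≤ ∣ P i ∣ + 3 * maxPart G Q ⊎ ∣ P a ∣ + ∣ P i ∣ ≤ maxPart G Q + ∣ W ∣
  bound-opt (inj₁ (k , small)) = inj₁ (≤-trans (n≤part+3max k) (+-monoˡ-≤ _ small))
  bound-opt (inj₂ (k , covered)) = inj₂ (≤-trans covered (+-monoˡ-≤ ∣ W ∣ (part≤max k)))

theorem7 : (n : ℕ) (G : Graph n) → Connected G ⊤ →
    (P : Fin 4 → Subset n) → FeasibleTetra G P → Sorted G P →
    5 * ∣ P (# 3) ∣ > 2 * n →
    ¬ MergeApplicable G P → ¬ PullApplicable G P →
    ∣ P (# 1) ∣ + ∣ P (# 2) ∣ ≥ ∣ P (# 3) ∣ →
    2 * ∣ P (# 3) ∣ < n →
    6 * ∣ P (# 1) ∣ < ∣ P (# 3) ∣ →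
    2 * ∣ P (# 3) ∣ < n →
    3 * ∣ P (# 2) ∣ > n →
    (i j : Fin 4) → (i ≡ # 0 × j ≡ # 1) ⊎ (i ≡ # 1 × j ≡ # 0) →
    (v u : Fin n) →
    AdjacentAt G (P i) (P (# 2)) v →
    AdjacentAt G (P j) (P (# 3)) u →
    ((V3' : Subset n) →
       ComponentsAdjacentTo G ((P (# 2) ∪ P i) ∩ ∁ ⁅ v ⁆) (P (# 3)) V3' →
       24 * ∣ V3' ∣ ≤ 24 * ∣ P i ∣ + 7 * ∣ P (# 3) ∣ →
       (opt : ℕ) → IsOPT G opt → 13 * ∣ P (# 3) ∣ ≤ 24 * opt)
    ×
    ((V4' : Subset n) →
       ComponentsAdjacentTo G ((P (# 3) ∪ P j) ∩ ∁ ⁅ u ⁆) (P (# 2)) V4' →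
       24 * ∣ V4' ∣ ≤ 24 * ∣ P j ∣ + 11 * ∣ P (# 3) ∣ →
       (opt : ℕ) → IsOPT G opt → 13 * ∣ P (# 3) ∣ ≤ 24 * opt)
theorem7 n G _ P fP sorted _ no-merge no-pull d≤b+c 2d<n 6b<d _ _ i j ij v u at-v at-u =
  (λ V₃' V₃'-comps V₃'-small opt isOPT → stable (¬¬-map
     [ smallPart-bound n d b _ opt 2d<n 6b<d (bounded r)
     , hubInV₃-bound b c d opt _ _ d≤b+c 6b<d V₃'-small ]
     (hub-dichotomy G P fP no-merge no-pull r big₂₃ (pair<d r) (≤-<-trans (pair≤2b r) (double<c b c d d≤b+c 6b<d))
        at-v V₃'-comps isOPT)))
  ,
  (λ V₄' V₄'-comps V₄'-small opt isOPT → stable (¬¬-map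
     [ smallPart-bound n d b _ opt 2d<n 6b<d (bounded r')
     , hubInV₄-bound d opt _ _ V₄'-small ]
     (hub-dichotomy G P fP no-merge no-pull r' big₃₂ (pair<d r') (pair<d r') at-u V₄'-comps isOPT)))
  where
  b = ∣ P (# 1) ∣
  c = ∣ P (# 2) ∣
  d = ∣ P (# 3) ∣
  r : Roles i j
  r = toRoles ij
  r' : Roles j i
  r' = roles-swap r

  stable : ∀ {x y} → DoubleNegation (x ≤ y) → x ≤ y
  stable = decidable-stable (_ ≤? _)

  bounded : ∀ {k l} → Roles k l → ∣ P k ∣ ≤ b
  bounded = roles-bounded {G = G} {P = P} sorted

  pair≤2b : ∀ {k l} → Roles k l → ∣ P k ∣ + ∣ P l ∣ ≤ b + b
  pair≤2b r = +-mono-≤ (bounded r) (bounded (roles-swap r))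

  pair<d : ∀ {k l} → Roles k l → ∣ P k ∣ + ∣ P l ∣ < d
  pair<d r = ≤-<-trans (pair≤2b r) (double<d b d 6b<d)
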